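{- Let $H$ be a pseudoexpander and let $S$ be a guarded set of literals over a subset of $V(H)$. Then $Pr({\bf EC}(S))=2^{ -|S\setminus Fix(S)|}$.
   Context: Binary-tree-based graph: $H$ is an edge-disjoint union of extended rooted trees (no leaf has a sibling) $T_1,\dots,T_m$ with roots $t_1,\dots,t_m$, each vertex that is a leaf of some $T_i$ is a leaf of exactly two trees, and any two trees share at most one vertex, a leaf of both. Leaf variables are leaves of the trees; non-leaf variables are the others. If $T_i,T_j$ share a leaf $\ell_{i,j}$, $\{t_i,t_j\}$ is a pseudoedge and $P_{i,j}$ is the path from $t_i$ to $t_j$ in $T_i\cup T_j$. $H$ is a pseudoexpander if every tree has height (max vertices on a root–leaf path) $\le(\log_2 m)/4.9+3$ and any two disjoint root sets of size $\ge m^{0.999}$ admit at least $m^{0.999}/3$ pseudoedges with pairwise disjoint ends each having one end in each set. $\phi_H$: monotone CNF over $V(H)$ with clauses $C_{i,j}=\bigvee_{v\in V(P_{i,j})}v$, one per pseudoedge. Sets of literals never contain a variable with its negation. $S$ is guarded if for every clause $C_{i,j}$ at least one holds: (a) $\ell_{i,j}$ does not occur in $S$; (b) some non-leaf variable of $C_{i,j}$ occurs positively in $S$; (c) $\ell_{i,j}$ occurs positively in $S$ and all other variables of $C_{i,j}$ occur negatively in $S$. $Fix(S)$: positive literals $\ell_{i,j}\in S$ with all other variables of $C_{i,j}$ negative in $S$. Probability space on ${\bf SAT}(H)$ (sets of literals over all of $V(H)$ satisfying $\phi_H$) with $Pr(\{S\})=2^{ -|S\setminus Fix(S)|}$; ${\bf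 EC}(S)=\{S'\in{\bf SAT}(H):S\subseteq S'\}$. -}

module Defs where

open import Data.Nat using (ℕ; zero; suc; _+_; _*_; _∸_; _^_; _≤_; _<_)
open import Data.Bool using (Bool; true; false; _∧_; _∨_; not; if_then_else_)
open import Data.Maybe using (Maybe; just; nothing)
open import Data.Fin using (Fin; toℕ; _≟_)
open import Data.Fin.Subset using (Subset; _∈_; ∣_∣)
open import Data.List using (List; []; _∷_; _++_; map; filterᵇ; allFin; length; foldr; cartesianProduct; concatMap)
open import Data.Bool.ListAction using (any; all)
open import Data.List.Membership.Propositional renaming (_∈_ to _∈ₗ_)
open import Data.List.Relation.Unary.All using (All)
open import Data.List.Relation.Unary.Unique.Propositional using (Unique)
open import Data.Product using (Σ; ∃; ∃-syntax; _×_; _,_; proj₁; proj₂)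
open import Data.Sum using (_⊎_)
open import Data.Rational using (ℚ; 0ℚ; 1ℚ; ½) renaming (_+_ to _+ℚ_; _*_ to _*ℚ_)
open import Relation.Binary.PropositionalEquality using (_≡_; _≢_)
open import Relation.Nullary.Decidable using (⌊_⌋)
open import Data.Empty using (⊥)

_==_ : ∀ {n} → Fin n → Fin n → Bool
v == w = ⌊ v ≟ w ⌋

iter : ∀ {A : Set} → (A → A) → ℕ → A → A
iter f zero    x = x
iter f (suc k) x = iter f k (f x)

halfPow : ℕ → ℚ
halfPow zero    = 1ℚ
halfPow (suc k) = ½ *ℚ halfPow k

sumℚ : List ℚ → ℚ
sumℚ = foldr _+ℚ_ 0ℚ

count : ∀ {A : Set} → (A → Bool) → List A → ℕ
count p xs = length (filterᵇ p xs)

allAssign : (n : ℕ) → List (Fin n → Bool)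
allAssign zero    = (λ ()) ∷ []
allAssign (suc n) =
  concatMap (λ σ → (λ { Fin.zero → false ; (Fin.suc i) → σ i })
                 ∷ (λ { Fin.zero → true  ; (Fin.suc i) → σ i }) ∷ []) (allAssign n)

-- Raw data of a family of m rooted trees on the vertex set Fin n.
-- Tree i has vertex set {v | mem i v ≡ true}, root (root i), and every
-- non-root vertex v of tree i has parent (par i v) in tree i.

record TreeData (n m : ℕ) : Set where
  field
    mem  : Fin m → Fin n → Bool
    root : Fin m → Fin n
    par  : Fin m → Fin n → Fin n

module _ {n m : ℕ} (D : TreeData n m) where
  open TreeData D

  isChild : Fin m → Fin n → Fin n → Bool
  isChild i v w = mem i w ∧ not (w == root i) ∧ (par i w == v)

  isLeaf : Fin m → Fin n → Bool
  isLeaf i v = mem i v ∧ not (any (isChild i v) (allFin n))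

  isLeafVar : Fin n → Bool
  isLeafVar v = any (λ i → isLeaf i v) (allFin m)

  -- the vertices of the path from v up to the root of tree i
  -- (climbing parents, stopping at the root; fuel n suffices in a tree)
  climb : ℕ → Fin m → Fin n → List (Fin n)
  climb zero    i v = []
  climb (suc f) i v = if v == root i then v ∷ [] else v ∷ climb f i (par i v)

  pathUp : Fin m → Fin n → List (Fin n)
  pathUp i v = climb n i v

  -- pseudoedges, recorded as triples (i , j , ℓ) with toℕ i < toℕ j and
  -- ℓ = ℓ_{i,j} the common leaf of T_i and T_j
  isPseudo : Fin m × Fin m × Fin n → Bool
  isPseudo (i , j , l) = ⌊ toℕ i Data.Nat.<? toℕ j ⌋ ∧ isLeaf i l ∧ isLeaf j l

  pseudoedges : List (Fin m × Fin m × Fin n)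
  pseudoedges = filterᵇ isPseudo (cartesianProduct (allFin m) (cartesianProduct (allFin m) (allFin n)))

  clauseLeaf : Fin m × Fin m × Fin n → Fin n
  clauseLeaf (i , j , l) = l

  -- variables of C_{i,j} = vertices of P_{i,j} (path t_i → ℓ_{i,j} → t_j)
  clauseVars : Fin m × Fin m × Fin n → List (Fin n)
  clauseVars (i , j , l) = pathUp i l ++ pathUp j l

  record IsBTBGraph : Set where
    field
      root-mem    : ∀ i → mem i (root i) ≡ true
      par-mem     : ∀ i v → mem i v ≡ true → v ≢ root i → mem i (par i v) ≡ true
      reach-root  : ∀ i v → mem i v ≡ true → ∃[ k ] iter (par i) k v ≡ root i
      no-sibling  : ∀ i v w → isLeaf i v ≡ true → v ≢ root i →
                    mem i w ≡ true → w ≢ root i → w ≢ v → par i w ≢ par i v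
      covers      : ∀ v → ∃[ i ] mem i v ≡ true
      leaf-two    : ∀ i v → isLeaf i v ≡ true →
                    ∃[ j ] (j ≢ i × isLeaf j v ≡ true ×
                            (∀ k → isLeaf k v ≡ true → k ≡ i ⊎ k ≡ j))
      share-leaf  : ∀ i j v → i ≢ j → mem i v ≡ true → mem j v ≡ true →
                    isLeaf i v ≡ true × isLeaf j v ≡ true
      share-one   : ∀ i j v w → i ≢ j → mem i v ≡ true → mem j v ≡ true →
                    mem i w ≡ true → mem j w ≡ true → v ≡ w

  Pseudo : Fin m → Fin m → Set
  Pseudo i j = i ≢ j × ∃[ l ] (isLeaf i l ≡ true × isLeaf j l ≡ true)

  Disjoint : Subset m → Subset m → Set
  Disjoint A B = ∀ i → i ∈ A → i ∈ B → ⊥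

  ends : List (Fin m × Fin m) → List (Fin m)
  ends = concatMap (λ e → proj₁ e ∷ proj₂ e ∷ [])

  -- Real-valued thresholds are rewritten over ℕ:
  --   h ≤ log₂ m / 4.9 + 3   ⇔   2^(49·(h∸3)) ≤ m^10
  --   x ≥ m^0.999            ⇔   x^1000 ≥ m^999      (x ≥ 0)
  --   k ≥ m^0.999 / 3        ⇔   (3k)^1000 ≥ m^999
  -- Height of T_i = max number of vertices on a root–leaf path.
  record IsPseudoexpander : Set where
    field
      btb    : IsBTBGraph
      height : ∀ i l → isLeaf i l ≡ true →
               2 ^ (49 * (length (pathUp i l) ∸ 3)) ≤ m ^ 10
      expand : ∀ (A B : Subset m) → Disjoint A B →
               m ^ 999 ≤ ∣ A ∣ ^ 1000 → m ^ 999 ≤ ∣ B ∣ ^ 1000 →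
               ∃[ es ] (All (λ e → proj₁ e ∈ A × proj₂ e ∈ B × Pseudo (proj₁ e) (proj₂ e)) es
                        × Unique (ends es)
                        × m ^ 999 ≤ (3 * length es) ^ 1000)

  -- Sets of literals over (a subset of) V(H), without complementary pairs:
  -- S v ≡ just true  : literal v ∈ S;  S v ≡ just false : literal ¬v ∈ S;
  -- S v ≡ nothing    : v does not occur in S.
  Literals : Set
  Literals = Fin n → Maybe Bool

  isPos : Maybe Bool → Bool
  isPos (just true) = true
  isPos _           = false

  isNeg : Maybe Bool → Bool
  isNeg (just false) = true
  isNeg _            = false

  occurs : Maybe Bool → Bool
  occurs (just _) = true
  occurs nothing  = false

  Guarded : Literals → Set
  Guarded S = ∀ c → c ∈ₗ pseudoedges →
      S (clauseLeaf c) ≡ nothing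
    ⊎ (∃[ w ] (w ∈ₗ clauseVars c × isLeafVar w ≡ false × S w ≡ just true))
    ⊎ (S (clauseLeaf c) ≡ just true ×
       (∀ w → w ∈ₗ clauseVars c → w ≢ clauseLeaf c → S w ≡ just false))

  inFix : Literals → Fin n → Bool
  inFix S v = isPos (S v) ∧
    any (λ c → (clauseLeaf c == v) ∧
               all (λ w → (w == clauseLeaf c) ∨ isNeg (S w)) (clauseVars c))
        pseudoedges

  sizeNonFix : Literals → ℕ
  sizeNonFix S = count (λ v → occurs (S v) ∧ not (inFix S v)) (allFin n)

  satisfies : (Fin n → Bool) → Bool
  satisfies σ = all (λ c → any σ (clauseVars c)) pseudoedges

  toLits : (Fin n → Bool) → Literals
  toLits σ v = just (σ v)

  extends : Literals → (Fin n → Bool) → Bool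
  extends S σ = all (λ v → agree (S v) (σ v)) (allFin n)
    where
      agree : Maybe Bool → Bool → Bool
      agree nothing  _     = true
      agree (just a) b     = ⌊ a Data.Bool.≟ b ⌋

  PrPoint : (Fin n → Bool) → ℚ
  PrPoint σ = halfPow (sizeNonFix (toLits σ))

  PrEC : Literals → ℚ
  PrEC S = sumℚ (map PrPoint (filterᵇ (λ σ → satisfies σ ∧ extends S σ) (allAssign n)))

module Submission where

-- Induct on the number of unset variables of a guarded S, splitting EC(S) on an unset v into
-- EC(S[v≔1]) and EC(S[v≔0]).  Call v forced when some clause with leaf v has all its other
-- literals negative in S.  If v is unforced, both extensions are guarded and each adds one literal
-- outside Fix, so the halves sum to 2·2^-(k+1) = 2^-k.  If v is forced, setting it to 0 falsifies
-- that clause, so that half is empty, while setting it to 1 puts v into Fix and leaves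
-- |S ∖ Fix(S)| unchanged.  Non-leaf variables, which are never forced, are set first: then every
-- clause at a leaf v is all-negative elsewhere or has a positive inner literal, which keeps the
-- extensions guarded.  A total guarded S is a satisfying assignment, the single point of its EC.
-- Only two facts about H are used: the leaf of a clause is a leaf variable and its other
-- variables are not.

open import Defs
open import Data.Nat using (ℕ; zero; suc; _<?_)
import Data.Nat.Properties as ℕ
open import Data.Bool using (Bool; true; false; T; _∧_; _∨_; not; if_then_else_)
import Data.Bool as Bool
open import Data.Bool.Properties using (T-≡; ∧-conicalˡ; ∧-conicalʳ; ∧-zeroʳ; ¬-not; not-¬)
open import Data.Bool.ListAction using (any; all; and; or)
open import Data.Maybe using (Maybe; just; nothing; is-nothing)
import Data.Maybe.Properties as Maybe
open import Data.Fin using (Fin; _≟_; toℕ) renaming (zero to fzero; suc to fsuc)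
open import Data.Fin.Properties using (any?; suc-injective)
open import Data.List using (List; []; _∷_; _++_; map; filterᵇ; allFin; tabulate; concatMap; length; cartesianProduct)
open import Data.List.Properties using (map-cong; map-tabulate; filter-≐)
open import Data.List.Membership.Propositional using (_∈_; find; lose)
open import Data.List.Membership.Propositional.Properties using (∈-allFin; ∈-filter⁻; ∈-++⁻; ∈-++⁺ˡ)
open import Data.List.Relation.Unary.Any using (here; there)
open import Data.List.Relation.Unary.Any.Properties using (any⁺; any⁻)
import Data.List.Relation.Unary.All as All
open import Data.List.Relation.Unary.All.Properties using (all⁺; all⁻)
open import Data.Vec.Functional using (head; tail) renaming (_∷_ to _◂_)
open import Data.Product using (∃-syntax; _×_; _,_; proj₁; proj₂)
open import Data.Sum using (_⊎_; inj₁; inj₂)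
open import Data.Empty using (⊥-elim)
open import Data.Rational using (ℚ; 0ℚ; ½) renaming (_+_ to _+ℚ_)
import Data.Rational.Properties as ℚ
open import Function using (id; _∘_; _⇔_; mk⇔; Equivalence)
open import Relation.Binary.PropositionalEquality
open import Relation.Nullary using (Dec; yes; no; ¬_; contradiction)
open import Relation.Nullary.Decidable using (⌊_⌋; _×-dec_; isYes≗does; dec-true; dec-false)

open Equivalence using (to; from)
open import Algebra.Bundles using (CommutativeMonoid)
open import Algebra.Properties.CommutativeSemigroup (CommutativeMonoid.commutativeSemigroup ℚ.+-0-commutativeMonoid)
  using () renaming (interchange to +-interchange)

module _ {A : Set} (p : A → Bool) where

  any-intro : ∀ {x xs} → x ∈ xs → p x ≡ true → any p xs ≡ true
  any-intro x∈xs px = to T-≡ (any⁺ p (lose x∈xs (from T-≡ px)))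

  any-elim : ∀ xs → any p xs ≡ true → ∃[ x ] (x ∈ xs × p x ≡ true)
  any-elim xs e with x , x∈xs , px ← find (any⁻ p xs (from T-≡ e)) = x , x∈xs , to T-≡ px

  all-intro : ∀ xs → (∀ {x} → x ∈ xs → p x ≡ true) → all p xs ≡ true
  all-intro xs h = to T-≡ (all⁻ p (All.tabulate (from T-≡ ∘ h)))

  all-elim : ∀ xs {x} → all p xs ≡ true → x ∈ xs → p x ≡ true
  all-elim xs e = to T-≡ ∘ All.lookup (all⁺ p xs (from T-≡ e))

  all-false : ∀ xs → all p xs ≡ false → ∃[ x ] (x ∈ xs × p x ≡ false)
  all-false (x ∷ xs) e with p x in px
  ... | false = x , here refl , px
  ... | true with y , y∈xs , py ← all-false xs e = y , there y∈xs , py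

  count-cong : ∀ {q} → p ≗ q → ∀ xs → count p xs ≡ count q xs
  count-cong p≗q xs = cong length (filter-≐ _ _ (subst T (p≗q _) , subst T (sym (p≗q _))) xs)

  count-map : ∀ {B : Set} (f : B → A) xs → count p (map f xs) ≡ count (p ∘ f) xs
  count-map f [] = refl
  count-map f (x ∷ xs) with p (f x)
  ... | true  = cong suc (count-map f xs)
  ... | false = count-map f xs

  count-zero : ∀ {x xs} → count p xs ≡ 0 → x ∈ xs → p x ≡ false
  count-zero {xs = y ∷ ys} e x∈ with p y in py | x∈
  ... | false | here refl = py
  ... | false | there x∈ys = count-zero e x∈ys

  count-suc : ∀ xs {k} → count p xs ≡ suc k → ∃[ x ] p x ≡ true
  count-suc (x ∷ xs) e with p x in px
  ... | true  = x , px
  ... | false = count-suc xs e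

bool-ext : ∀ {a b} → (a ≡ true → b ≡ true) → (b ≡ true → a ≡ true) → a ≡ b
bool-ext {false} {false} _ _ = refl
bool-ext {false} {true}  _ b⇒a = b⇒a refl
bool-ext {true}          a⇒b _ = sym (a⇒b refl)

∧-cong-true : ∀ a {x y} → (a ≡ true → x ≡ y) → a ∧ x ≡ a ∧ y
∧-cong-true false _   = refl
∧-cong-true true  x≡y = x≡y refl

==-refl : ∀ {k} (v : Fin k) → (v == v) ≡ true
==-refl v = trans (isYes≗does (v ≟ v)) (dec-true (v ≟ v) refl)

≢⇒==-false : ∀ {k} {v w : Fin k} → v ≢ w → (v == w) ≡ false
≢⇒==-false {v = v} {w} v≢w = trans (isYes≗does (v ≟ w)) (dec-false (v ≟ w) v≢w)

==-false⇒≢ : ∀ {k} {v w : Fin k} → (v == w) ≡ false → v ≢ w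
==-false⇒≢ {v = v} {w} e with v ≟ w
... | no v≢w = v≢w

==⇒≡ : ∀ {k} {v w : Fin k} → (v == w) ≡ true → v ≡ w
==⇒≡ {v = v} {w} e with v ≟ w
... | yes v≡w = v≡w

count-tabulate-fsuc : ∀ {k} (p : Fin (suc k) → Bool) → count p (tabulate fsuc) ≡ count (p ∘ fsuc) (allFin k)
count-tabulate-fsuc {k} p = trans (cong (count p) (sym (map-tabulate id fsuc))) (count-map p fsuc (allFin k))

count-allFin-suc : ∀ {k} (p : Fin (suc k) → Bool) →
  count p (allFin (suc k)) ≡ (if p fzero then suc (count (p ∘ fsuc) (allFin k)) else count (p ∘ fsuc) (allFin k))
count-allFin-suc p with p fzero
... | true  = cong suc (count-tabulate-fsuc p)
... | false = count-tabulate-fsuc p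

count-insert : ∀ {k} (p q : Fin k → Bool) v → (∀ w → w ≢ v → q w ≡ p w) →
  p v ≡ false → q v ≡ true → count q (allFin k) ≡ suc (count p (allFin k))
count-insert {suc k} p q fzero q≡p pv qv
  rewrite count-allFin-suc p | count-allFin-suc q | pv | qv =
  cong suc (count-cong (q ∘ fsuc) (λ w → q≡p (fsuc w) λ ()) (allFin k))
count-insert {suc k} p q (fsuc v) q≡p pv qv
  rewrite count-allFin-suc p | count-allFin-suc q | q≡p fzero (λ ())
  with p fzero | count-insert (p ∘ fsuc) (q ∘ fsuc) v (λ w w≢v → q≡p (fsuc w) (w≢v ∘ suc-injective)) pv qv
... | true  | tail-count = cong suc tail-count
... | false | tail-count = tail-count

-- Sums over assignments

private variable A B : Set

sumℚ-filter : (f : A → ℚ) (p : A → Bool) (xs : List A) →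
  sumℚ (map f (filterᵇ p xs)) ≡ sumℚ (map (λ x → if p x then f x else 0ℚ) xs)
sumℚ-filter f p [] = refl
sumℚ-filter f p (x ∷ xs) with p x
... | true  = cong (f x +ℚ_) (sumℚ-filter f p xs)
... | false = trans (sumℚ-filter f p xs) (sym (ℚ.+-identityˡ _))

sumℚ-++ : (f : A → ℚ) (xs ys : List A) → sumℚ (map f (xs ++ ys)) ≡ sumℚ (map f xs) +ℚ sumℚ (map f ys)
sumℚ-++ f [] ys = sym (ℚ.+-identityˡ _)
sumℚ-++ f (x ∷ xs) ys = trans (cong (f x +ℚ_) (sumℚ-++ f xs ys)) (sym (ℚ.+-assoc (f x) _ _))

sumℚ-concatMap : (f : B → ℚ) (g : A → List B) (xs : List A) →
  sumℚ (map f (concatMap g xs)) ≡ sumℚ (map (λ x → sumℚ (map f (g x))) xs)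
sumℚ-concatMap f g [] = refl
sumℚ-concatMap f g (x ∷ xs) =
  trans (sumℚ-++ f (g x) (concatMap g xs)) (cong (sumℚ (map f (g x)) +ℚ_) (sumℚ-concatMap f g xs))

sumℚ-+ : (f g : A → ℚ) (xs : List A) →
  sumℚ (map (λ x → f x +ℚ g x) xs) ≡ sumℚ (map f xs) +ℚ sumℚ (map g xs)
sumℚ-+ f g [] = refl
sumℚ-+ f g (x ∷ xs) = trans (cong ((f x +ℚ g x) +ℚ_) (sumℚ-+ f g xs)) (+-interchange (f x) (g x) _ _)

sumℚ-zero : ∀ xs → sumℚ (map (λ (_ : A) → 0ℚ) xs) ≡ 0ℚ
sumℚ-zero [] = refl
sumℚ-zero (x ∷ xs) = trans (ℚ.+-identityˡ _) (sumℚ-zero xs)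

Assignment : ℕ → Set
Assignment k = Fin k → Bool

Sum : (k : ℕ) → (Assignment k → ℚ) → ℚ
Sum k F = sumℚ (map F (allAssign k))

Extensional : ∀ {k} → (Assignment k → ℚ) → Set
Extensional F = ∀ {σ τ} → σ ≗ τ → F σ ≡ F τ

Sum-cong : ∀ {k} {F G : Assignment k → ℚ} → F ≗ G → Sum k F ≡ Sum k G
Sum-cong {k} F≗G = cong sumℚ (map-cong F≗G (allAssign k))

Sum-suc : ∀ {k} (F : Assignment (suc k) → ℚ) → Extensional F →
  Sum (suc k) F ≡ Sum k (λ σ → F (false ◂ σ) +ℚ F (true ◂ σ))
Sum-suc {k} F F-ext = trans (sumℚ-concatMap F _ (allAssign k)) (Sum-cong {k} λ σ →
  cong₂ _+ℚ_ (F-ext λ { fzero → refl ; (fsuc i) → refl })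
             (trans (ℚ.+-identityʳ _) (F-ext λ { fzero → refl ; (fsuc i) → refl })))

Sum-indicator : ∀ {k} (P : Assignment k → Bool) (F : Assignment k → ℚ) (τ : Assignment k) →
  (∀ σ → P σ ≡ true ⇔ σ ≗ τ) → Extensional F →
  Sum k (λ σ → if P σ then F σ else 0ℚ) ≡ F τ
Sum-indicator {zero} P F τ P⇔ F-ext = trans (ℚ.+-identityʳ _) (at-empty _)
  where
  at-empty : ∀ σ → (if P σ then F σ else 0ℚ) ≡ F τ
  at-empty σ rewrite from (P⇔ σ) (λ ()) = F-ext λ ()
Sum-indicator {suc k} P F τ P⇔ F-ext = begin
  Sum (suc k) G                                            ≡⟨ Sum-suc G G-ext ⟩
  Sum k (λ σ → G (false ◂ σ) +ℚ G (true ◂ σ))              ≡⟨ Sum-cong pair ⟩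
  Sum k (λ σ → G (head τ ◂ σ))
    ≡⟨ Sum-indicator (P ∘ (head τ ◂_)) (F ∘ (head τ ◂_)) (tail τ) tail⇔ (F-ext ∘ cons-cong) ⟩
  F (head τ ◂ tail τ)                                      ≡⟨ F-ext (λ { fzero → refl ; (fsuc i) → refl }) ⟩
  F τ                                                      ∎
  where
  open ≡-Reasoning
  G : Assignment (suc k) → ℚ
  G σ = if P σ then F σ else 0ℚ

  P-cong : ∀ {σ σ'} → σ ≗ σ' → P σ ≡ P σ'
  P-cong σ≗σ' = bool-ext (λ Pσ → from (P⇔ _) λ i → trans (sym (σ≗σ' i)) (to (P⇔ _) Pσ i))
                         (λ Pσ' → from (P⇔ _) λ i → trans (σ≗σ' i) (to (P⇔ _) Pσ' i))

  G-ext : Extensional G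
  G-ext σ≗σ' = cong₂ (λ b x → if b then x else 0ℚ) (P-cong σ≗σ') (F-ext σ≗σ')

  cons-cong : ∀ {b σ σ'} → σ ≗ σ' → (b ◂ σ) ≗ (b ◂ σ')
  cons-cong σ≗σ' fzero    = refl
  cons-cong σ≗σ' (fsuc i) = σ≗σ' i

  tail⇔ : ∀ σ → P (head τ ◂ σ) ≡ true ⇔ σ ≗ tail τ
  tail⇔ σ = mk⇔ (λ Pσ → to (P⇔ _) Pσ ∘ fsuc)
                (λ σ≗ → from (P⇔ _) λ { fzero → refl ; (fsuc i) → σ≗ i })

  off : ∀ b σ → b ≢ head τ → G (b ◂ σ) ≡ 0ℚ
  off b σ b≢ with P (b ◂ σ) in Pbσ
  ... | true  = contradiction (to (P⇔ _) Pbσ fzero) b≢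
  ... | false = refl

  pair : ∀ σ → G (false ◂ σ) +ℚ G (true ◂ σ) ≡ G (head τ ◂ σ)
  pair σ with head τ in τ₀
  ... | true  = trans (cong (_+ℚ G (true ◂ σ)) (off false σ (not-¬ τ₀ ∘ sym))) (ℚ.+-identityˡ _)
  ... | false = trans (cong (G (false ◂ σ) +ℚ_) (off true σ (not-¬ τ₀ ∘ sym))) (ℚ.+-identityʳ _)

halfPow-double : ∀ k → halfPow (suc k) +ℚ halfPow (suc k) ≡ halfPow k
halfPow-double k = trans (sym (ℚ.*-distribʳ-+ (halfPow k) ½ ½)) (ℚ.*-identityˡ (halfPow k))

-- Clauses of a binary-tree-based graph

climb-head : ∀ {n m} (D : TreeData n m) f t v → v ∈ climb D (suc f) t v
climb-head D f t v with v == TreeData.root D t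
... | true  = here refl
... | false = here refl

clauseLeaf∈clauseVars : ∀ {n m} (D : TreeData n m) c → clauseLeaf D c ∈ clauseVars D c
clauseLeaf∈clauseVars {suc n} D (i , j , l) = ∈-++⁺ˡ (climb-head D n i l)

module _ {n m} (D : TreeData n m) (btb : IsBTBGraph D) where
  open TreeData D
  open IsBTBGraph btb

  pseudoedge-isLeaf : ∀ {i j l} → (i , j , l) ∈ pseudoedges D → isLeaf D i l ≡ true × isLeaf D j l ≡ true
  pseudoedge-isLeaf {i} {j} {l} e∈ = ∧-conicalˡ (isLeaf D i l) _ leaves , ∧-conicalʳ (isLeaf D i l) _ leaves
    where
    pseudo : isPseudo D (i , j , l) ≡ true
    pseudo = to T-≡ (proj₂ (∈-filter⁻ (Bool.T? ∘ isPseudo D) {xs = triples} e∈))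
      where triples = cartesianProduct (allFin m) (cartesianProduct (allFin m) (allFin n))
    leaves : isLeaf D i l ∧ isLeaf D j l ≡ true
    leaves = ∧-conicalʳ ⌊ toℕ i <? toℕ j ⌋ _ pseudo

  isLeaf⇒isLeafVar : ∀ {t v} → isLeaf D t v ≡ true → isLeafVar D v ≡ true
  isLeaf⇒isLeafVar {t} {v} = any-intro (λ k → isLeaf D k v) (∈-allFin t)

  IsParent : Fin m → Fin n → Set
  IsParent t u = ∃[ x ] (mem t x ≡ true × x ≢ root t × par t x ≡ u)

  climb-parent : ∀ f t {u v} → mem t v ≡ true → u ∈ climb D f t v → u ≡ v ⊎ IsParent t u
  climb-parent (suc f) t {u} {v} mv u∈ with v == root t in v=r | u∈
  ... | true  | here u≡v = inj₁ u≡v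
  ... | false | here u≡v = inj₁ u≡v
  ... | false | there u∈' with climb-parent f t (par-mem t v mv (==-false⇒≢ v=r)) u∈'
  ...   | inj₁ refl  = inj₂ (v , mv , ==-false⇒≢ v=r , refl)
  ...   | inj₂ above = inj₂ above

  parent-not-leaf : ∀ {t u} → IsParent t u → isLeaf D t u ≡ false
  parent-not-leaf {t} {u} (x , mx , x≢r , refl) =
    trans (cong (λ b → mem t u ∧ not b) (any-intro (isChild D t u) (∈-allFin x) child)) (∧-zeroʳ _)
    where
    child : isChild D t u x ≡ true
    child rewrite mx | ≢⇒==-false x≢r | ==-refl u = refl

  parent-not-leafVar : ∀ {t u} → IsParent t u → isLeafVar D u ≡ false
  parent-not-leafVar {t} {u} parent@(x , mx , x≢r , px≡u) = ¬-not λ leafVar →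
    let k , _ , leaf-k = any-elim (λ k → isLeaf D k u) (allFin m) leafVar
    in contradiction (leaf-in-t k leaf-k) (not-¬ (parent-not-leaf parent))
    where
    mu : mem t u ≡ true
    mu = subst (λ w → mem t w ≡ true) px≡u (par-mem t x mx x≢r)
    leaf-in-t : ∀ k → isLeaf D k u ≡ true → isLeaf D t u ≡ true
    leaf-in-t k leaf-k with t ≟ k
    ... | yes refl = leaf-k
    ... | no t≢k   = proj₁ (share-leaf t k u t≢k mu (∧-conicalˡ _ _ leaf-k))

  pathUp-nonLeafVar : ∀ {t l u} → isLeaf D t l ≡ true → u ∈ pathUp D t l → u ≢ l → isLeafVar D u ≡ false
  pathUp-nonLeafVar {t} leaf u∈ u≢l with climb-parent n t (∧-conicalˡ _ _ leaf) u∈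
  ... | inj₁ u≡l   = contradiction u≡l u≢l
  ... | inj₂ above = parent-not-leafVar above

  clauseLeaf-isLeafVar : ∀ {c} → c ∈ pseudoedges D → isLeafVar D (clauseLeaf D c) ≡ true
  clauseLeaf-isLeafVar e∈ = isLeaf⇒isLeafVar (proj₁ (pseudoedge-isLeaf e∈))

  clauseVars-nonLeafVar : ∀ {c w} → c ∈ pseudoedges D → w ∈ clauseVars D c → w ≢ clauseLeaf D c →
                          isLeafVar D w ≡ false
  clauseVars-nonLeafVar {i , j , l} e∈ w∈ with ∈-++⁻ (pathUp D i l) w∈
  ... | inj₁ w∈i = pathUp-nonLeafVar (proj₁ (pseudoedge-isLeaf e∈)) w∈i
  ... | inj₂ w∈j = pathUp-nonLeafVar (proj₂ (pseudoedge-isLeaf e∈)) w∈j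

-- Guarded sets of literals

module _ {n m} (D : TreeData n m)
  (clause-leafVar    : ∀ {c} → c ∈ pseudoedges D → isLeafVar D (clauseLeaf D c) ≡ true)
  (clause-nonLeafVar : ∀ {c w} → c ∈ pseudoedges D → w ∈ clauseVars D c → w ≢ clauseLeaf D c →
                       isLeafVar D w ≡ false)
  where

  Clause : Set
  Clause = Fin m × Fin m × Fin n

  _[_≔_] : Literals D → Fin n → Bool → Literals D
  (S [ v ≔ b ]) w = if w == v then just b else S w

  update-≡ : ∀ S v b → (S [ v ≔ b ]) v ≡ just b
  update-≡ S v b rewrite ==-refl v = refl

  update-≢ : ∀ S {v w} b → w ≢ v → (S [ v ≔ b ]) w ≡ S w
  update-≢ S b w≢v rewrite ≢⇒==-false w≢v = refl

  set≢unset : ∀ {S : Literals D} {w v a} → S w ≡ just a → S v ≡ nothing → w ≢ v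
  set≢unset Sw Sv refl with () ← trans (sym Sw) Sv

  _⊑_ : Literals D → Literals D → Set
  S ⊑ S' = ∀ w {a} → S w ≡ just a → S' w ≡ just a

  ⊑-update : ∀ {S v} b → S v ≡ nothing → S ⊑ (S [ v ≔ b ])
  ⊑-update {S} b Sv w Sw = trans (update-≢ S b (set≢unset Sw Sv)) Sw

  isPos-true : ∀ {x} → isPos D x ≡ true → x ≡ just true
  isPos-true {just true} _ = refl

  isNeg-true : ∀ {x} → isNeg D x ≡ true → x ≡ just false
  isNeg-true {just false} _ = refl

  nonLeafVar≢clauseLeaf : ∀ {c w} → c ∈ pseudoedges D → isLeafVar D w ≡ false → w ≢ clauseLeaf D c
  nonLeafVar≢clauseLeaf c∈ nonLeaf refl = not-¬ (clause-leafVar c∈) nonLeaf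

  _≼_ : Literals D → Assignment n → Set
  S ≼ σ = ∀ v {a} → S v ≡ just a → σ v ≡ a

  -- The per-variable test of extends is local to its definition in Defs, so it can only be
  -- reached by with-abstraction over S v and σ v.
  extends⇔≼ : ∀ S σ → extends D S σ ≡ true ⇔ S ≼ σ
  extends⇔≼ S σ = mk⇔ sound complete
    where
    sound : extends D S σ ≡ true → S ≼ σ
    sound e v Sv with S v | σ v | Sv | all-elim _ (allFin n) e (∈-allFin v)
    ... | just true  | true  | refl | _ = refl
    ... | just false | false | refl | _ = refl
    complete : S ≼ σ → extends D S σ ≡ true
    complete S≼σ with extends D S σ in e
    ... | true = refl
    ... | false with v , _ , disagree ← all-false _ (allFin n) e with S v | σ v | disagree | S≼σ v
    ...   | just true  | false | _  | agree = contradiction (agree refl) λ ()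
    ...   | just false | true  | _  | agree = contradiction (agree refl) λ ()
    ...   | just true  | true  | () | _
    ...   | just false | false | () | _
    ...   | nothing    | _     | () | _

  extends-update : ∀ {S v σ b} → S v ≡ nothing → σ v ≡ b → extends D (S [ v ≔ b ]) σ ≡ extends D S σ
  extends-update {S} {v} {σ} {b} Sv σv = bool-ext
    (λ e → from (extends⇔≼ S σ) λ w Sw → to (extends⇔≼ (S [ v ≔ b ]) σ) e w (⊑-update b Sv w Sw))
    (λ e → from (extends⇔≼ (S [ v ≔ b ]) σ) λ w → at w (to (extends⇔≼ S σ) e w))
    where
    at : ∀ w {a} → (S w ≡ just a → σ w ≡ a) → (S [ v ≔ b ]) w ≡ just a → σ w ≡ a
    at w S≼σ S'w with w ≟ v
    ... | yes refl = trans σv (Maybe.just-injective S'w)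
    ... | no _     = S≼σ S'w

  extends-update-≢ : ∀ S {v σ b} → σ v ≢ b → extends D (S [ v ≔ b ]) σ ≡ false
  extends-update-≢ S {v} {σ} {b} σv≢b =
    ¬-not λ e → σv≢b (to (extends⇔≼ (S [ v ≔ b ]) σ) e v (update-≡ S v b))

  satisfies-cong : ∀ {σ σ'} → σ ≗ σ' → satisfies D σ ≡ satisfies D σ'
  satisfies-cong σ≗σ' = cong and (map-cong (λ c → cong or (map-cong σ≗σ' (clauseVars D c))) (pseudoedges D))

  OthersNegative : Literals D → Clause → Set
  OthersNegative S c = ∀ w → w ∈ clauseVars D c → w ≢ clauseLeaf D c → S w ≡ just false

  PositiveInner : Literals D → Clause → Set
  PositiveInner S c = ∃[ w ] (w ∈ clauseVars D c × isLeafVar D w ≡ false × S w ≡ just true)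

  -- Guarded D S unfolds to ∀ c → c ∈ pseudoedges D → ClauseGuarded S c.
  ClauseGuarded : Literals D → Clause → Set
  ClauseGuarded S c = S (clauseLeaf D c) ≡ nothing ⊎ PositiveInner S c
                    ⊎ (S (clauseLeaf D c) ≡ just true × OthersNegative S c)

  othersNegative-agree : ∀ {S S' c} → (∀ w → w ≢ clauseLeaf D c → S' w ≡ S w) →
                         OthersNegative S c → OthersNegative S' c
  othersNegative-agree S'≡S neg w w∈ w≢l = trans (S'≡S w w≢l) (neg w w∈ w≢l)

  clauseGuarded-⊑ : ∀ {S S' c} → S ⊑ S' → S' (clauseLeaf D c) ≡ S (clauseLeaf D c) →
                    ClauseGuarded S c → ClauseGuarded S' c
  clauseGuarded-⊑ S⊑S' leaf-same (inj₁ unset) = inj₁ (trans leaf-same unset)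
  clauseGuarded-⊑ S⊑S' leaf-same (inj₂ (inj₁ (w , w∈ , nonLeaf , Sw))) =
    inj₂ (inj₁ (w , w∈ , nonLeaf , S⊑S' w Sw))
  clauseGuarded-⊑ S⊑S' leaf-same (inj₂ (inj₂ (Sl , neg))) =
    inj₂ (inj₂ (trans leaf-same Sl , λ w w∈ w≢l → S⊑S' w (neg w w∈ w≢l)))

  othersNegativeᵇ : Literals D → Clause → Bool
  othersNegativeᵇ S c = all (λ w → (w == clauseLeaf D c) ∨ isNeg D (S w)) (clauseVars D c)

  othersNegative-intro : ∀ {S c} → OthersNegative S c → othersNegativeᵇ S c ≡ true
  othersNegative-intro {S} {c} neg = all-intro _ (clauseVars D c) λ {w} w∈ → leaf-or-neg w (neg w w∈)
    where
    leaf-or-neg : ∀ w → (w ≢ clauseLeaf D c → S w ≡ just false) →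
                  (w == clauseLeaf D c) ∨ isNeg D (S w) ≡ true
    leaf-or-neg w neg-w with w ≟ clauseLeaf D c
    ... | yes _   = refl
    ... | no  w≢l rewrite neg-w w≢l = refl

  othersNegative-elim : ∀ {S c} → othersNegativeᵇ S c ≡ true → OthersNegative S c
  othersNegative-elim {S} {c} e w w∈ w≢l
    with leaf-or-neg ← all-elim _ (clauseVars D c) e w∈ rewrite ≢⇒==-false w≢l = isNeg-true leaf-or-neg

  othersNegative-witness : ∀ {S c} → othersNegativeᵇ S c ≡ false →
                           ∃[ w ] (w ∈ clauseVars D c × w ≢ clauseLeaf D c × isNeg D (S w) ≡ false)
  othersNegative-witness {S} {c} e with w , w∈ , fails ← all-false _ (clauseVars D c) e
    with w == clauseLeaf D c in w=l | fails
  ... | false | notNeg = w , w∈ , ==-false⇒≢ w=l , notNeg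

  Forced : Literals D → Fin n → Set
  Forced S v = ∃[ c ] (c ∈ pseudoedges D × clauseLeaf D c ≡ v × OthersNegative S c)

  -- inFix D S v unfolds to isPos (S v) ∧ forcedᵇ S v.
  forcedᵇ : Literals D → Fin n → Bool
  forcedᵇ S v = any (λ c → (clauseLeaf D c == v) ∧ othersNegativeᵇ S c) (pseudoedges D)

  forcedᵇ⇔ : ∀ S v → forcedᵇ S v ≡ true ⇔ Forced S v
  forcedᵇ⇔ S v = mk⇔
    (λ e → let c , c∈ , leaf∧neg = any-elim _ (pseudoedges D) e
           in c , c∈ , ==⇒≡ (∧-conicalˡ _ _ leaf∧neg) , othersNegative-elim (∧-conicalʳ _ _ leaf∧neg))
    (λ { (c , c∈ , refl , neg) →
         any-intro _ c∈ (cong₂ _∧_ (==-refl (clauseLeaf D c)) (othersNegative-intro neg)) })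

  forced-agree : ∀ {S S' v} → (∀ w → w ≢ v → S' w ≡ S w) → Forced S v → Forced S' v
  forced-agree S'≡S (c , c∈ , refl , neg) = c , c∈ , refl , othersNegative-agree S'≡S neg

  forcedᵇ-agree : ∀ {S S' v} → (∀ w → w ≢ v → S' w ≡ S w) → forcedᵇ S' v ≡ forcedᵇ S v
  forcedᵇ-agree {S} {S'} {v} S'≡S = bool-ext
    (λ e → from (forcedᵇ⇔ S v) (forced-agree (λ w w≢v → sym (S'≡S w w≢v)) (to (forcedᵇ⇔ S' v) e)))
    (λ e → from (forcedᵇ⇔ S' v) (forced-agree S'≡S (to (forcedᵇ⇔ S v) e)))

  forcedᵇ-update-self : ∀ S v b → forcedᵇ (S [ v ≔ b ]) v ≡ forcedᵇ S v
  forcedᵇ-update-self S v b = forcedᵇ-agree (λ w → update-≢ S b)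

  forced-⊑ : ∀ {S S' w} → S ⊑ S' → Forced S w → Forced S' w
  forced-⊑ S⊑S' (c , c∈ , l≡w , neg) = c , c∈ , l≡w , λ u u∈ u≢l → S⊑S' u (neg u u∈ u≢l)

  -- A clause at w guarded by a positive inner literal of S stays non-forcing in every extension.
  forced-⊑⁻ : ∀ {S S' w} → Guarded D S → S ⊑ S' → S w ≡ just true → Forced S' w → Forced S w
  forced-⊑⁻ {S} g S⊑S' Sw (c , c∈ , refl , neg') with g c c∈
  ... | inj₁ unset = contradiction (trans (sym Sw) unset) λ ()
  ... | inj₂ (inj₁ (u , u∈ , nonLeaf , Su)) =
    contradiction (trans (sym (S⊑S' u Su)) (neg' u u∈ (nonLeafVar≢clauseLeaf c∈ nonLeaf))) λ ()
  ... | inj₂ (inj₂ (_ , neg)) = c , c∈ , refl , neg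

  forcedᵇ-⊑ : ∀ {S S' w} → Guarded D S → S ⊑ S' → S w ≡ just true → forcedᵇ S' w ≡ forcedᵇ S w
  forcedᵇ-⊑ {S} {S'} {w} g S⊑S' Sw = bool-ext
    (λ e → from (forcedᵇ⇔ S w) (forced-⊑⁻ g S⊑S' Sw (to (forcedᵇ⇔ S' w) e)))
    (λ e → from (forcedᵇ⇔ S' w) (forced-⊑ S⊑S' (to (forcedᵇ⇔ S w) e)))

  forcedᵇ-nonLeafVar : ∀ {S v} → isLeafVar D v ≡ false → forcedᵇ S v ≡ false
  forcedᵇ-nonLeafVar {S} {v} nonLeaf = ¬-not λ e →
    let c , c∈ , l≡v , _ = to (forcedᵇ⇔ S v) e in nonLeafVar≢clauseLeaf c∈ nonLeaf (sym l≡v)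

  NonFix : Literals D → Fin n → Bool
  NonFix S w = occurs D (S w) ∧ not (inFix D S w)

  sizeNonFix-cong : ∀ {S S'} → S ≗ S' → sizeNonFix D S ≡ sizeNonFix D S'
  sizeNonFix-cong {S} {S'} S≗S' = count-cong (NonFix S) same (allFin n)
    where
    same : NonFix S ≗ NonFix S'
    same w = cong₂ (λ x f → occurs D x ∧ not (isPos D x ∧ f))
                   (S≗S' w) (sym (forcedᵇ-agree (λ u _ → sym (S≗S' u))))

  NonFix-update-other : ∀ {S v w} b → Guarded D S → S v ≡ nothing → w ≢ v →
                        NonFix (S [ v ≔ b ]) w ≡ NonFix S w
  NonFix-update-other {S} {v} {w} b g Sv w≢v rewrite update-≢ S b w≢v =
    cong (λ f → occurs D (S w) ∧ not f) (∧-cong-true (isPos D (S w)) λ pos →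
      forcedᵇ-⊑ g (⊑-update b Sv) (isPos-true pos))

  sizeNonFix-update-unforced : ∀ {S v} b → Guarded D S → S v ≡ nothing → forcedᵇ S v ≡ false →
                               sizeNonFix D (S [ v ≔ b ]) ≡ suc (sizeNonFix D S)
  sizeNonFix-update-unforced {S} {v} b g Sv unforced =
    count-insert (NonFix S) (NonFix (S [ v ≔ b ])) v (λ w → NonFix-update-other b g Sv) was-unset now-nonFix
    where
    was-unset : NonFix S v ≡ false
    was-unset rewrite Sv = refl
    now-nonFix : NonFix (S [ v ≔ b ]) v ≡ true
    now-nonFix rewrite update-≡ S v b | forcedᵇ-update-self S v b | unforced | ∧-zeroʳ (isPos D (just b)) = refl

  sizeNonFix-update-forced : ∀ {S v} → Guarded D S → S v ≡ nothing → forcedᵇ S v ≡ true →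
                             sizeNonFix D (S [ v ≔ true ]) ≡ sizeNonFix D S
  sizeNonFix-update-forced {S} {v} g Sv forced = count-cong (NonFix (S [ v ≔ true ])) same (allFin n)
    where
    same-at : ∀ w → Dec (w ≡ v) → NonFix (S [ v ≔ true ]) w ≡ NonFix S w
    same-at w (no w≢v)  = NonFix-update-other true g Sv w≢v
    same-at w (yes refl) rewrite update-≡ S w true | forcedᵇ-update-self S w true | forced | Sv = refl
    same : ∀ w → NonFix (S [ v ≔ true ]) w ≡ NonFix S w
    same w = same-at w (w ≟ v)

  -- Splitting EC(S) on one variable

  weight : Literals D → Assignment n → ℚ
  weight S σ = if satisfies D σ ∧ extends D S σ then PrPoint D σ else 0ℚ

  PrEC-Sum : ∀ S → PrEC D S ≡ Sum n (weight S)
  PrEC-Sum S = sumℚ-filter (PrPoint D) _ (allAssign n)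

  weight-update-≡ : ∀ {S v b} σ → S v ≡ nothing → σ v ≡ b → weight (S [ v ≔ b ]) σ ≡ weight S σ
  weight-update-≡ σ Sv σv = cong (λ e → if satisfies D σ ∧ e then PrPoint D σ else 0ℚ) (extends-update Sv σv)

  weight-update-≢ : ∀ S {v b} σ → σ v ≢ b → weight (S [ v ≔ b ]) σ ≡ 0ℚ
  weight-update-≢ S σ σv≢b = cong (λ e → if e then PrPoint D σ else 0ℚ)
    (trans (cong (satisfies D σ ∧_) (extends-update-≢ S σv≢b)) (∧-zeroʳ (satisfies D σ)))

  PrEC-split : ∀ {S v} → S v ≡ nothing → PrEC D S ≡ PrEC D (S [ v ≔ true ]) +ℚ PrEC D (S [ v ≔ false ])
  PrEC-split {S} {v} Sv = begin
    PrEC D S                                                      ≡⟨ PrEC-Sum S ⟩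
    Sum n (weight S)                                              ≡⟨ Sum-cong split ⟩
    Sum n (λ σ → weight (S [ v ≔ true ]) σ +ℚ weight (S [ v ≔ false ]) σ) ≡⟨ sumℚ-+ _ _ (allAssign n) ⟩
    Sum n (weight (S [ v ≔ true ])) +ℚ Sum n (weight (S [ v ≔ false ]))
      ≡⟨ sym (cong₂ _+ℚ_ (PrEC-Sum (S [ v ≔ true ])) (PrEC-Sum (S [ v ≔ false ]))) ⟩
    PrEC D (S [ v ≔ true ]) +ℚ PrEC D (S [ v ≔ false ])           ∎
    where
    open ≡-Reasoning
    split : ∀ σ → weight S σ ≡ weight (S [ v ≔ true ]) σ +ℚ weight (S [ v ≔ false ]) σ
    split σ with σ v in σv
    ... | true  = sym (trans (cong₂ _+ℚ_ (weight-update-≡ σ Sv σv) (weight-update-≢ S σ (not-¬ σv)))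
                             (ℚ.+-identityʳ _))
    ... | false = sym (trans (cong₂ _+ℚ_ (weight-update-≢ S σ (not-¬ σv)) (weight-update-≡ σ Sv σv))
                             (ℚ.+-identityˡ _))

  forced-false-unsat : ∀ {S v σ} → Forced S v → satisfies D σ ≡ true → ¬ (S [ v ≔ false ]) ≼ σ
  forced-false-unsat {S} {v} {σ} (c , c∈ , l≡v , neg) sat S'≼σ
    with u , u∈ , σu ← any-elim σ (clauseVars D c) (all-elim _ (pseudoedges D) sat c∈) =
    contradiction (trans (sym σu) (S'≼σ u (falsified u u∈ (u ≟ v)))) λ ()
    where
    falsified : ∀ u → u ∈ clauseVars D c → Dec (u ≡ v) → (S [ v ≔ false ]) u ≡ just false
    falsified u u∈ (yes refl) = update-≡ S u false
    falsified u u∈ (no u≢v)   = trans (update-≢ S false u≢v) (neg u u∈ (λ u≡l → u≢v (trans u≡l l≡v)))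

  PrEC-forced-false : ∀ {S v} → forcedᵇ S v ≡ true → PrEC D (S [ v ≔ false ]) ≡ 0ℚ
  PrEC-forced-false {S} {v} forced =
    trans (PrEC-Sum (S [ v ≔ false ])) (trans (Sum-cong {G = λ _ → 0ℚ} vanishes) (sumℚ-zero (allAssign n)))
    where
    vanishes : ∀ σ → weight (S [ v ≔ false ]) σ ≡ 0ℚ
    vanishes σ with satisfies D σ ∧ extends D (S [ v ≔ false ]) σ in sat∧ext
    ... | false = refl
    ... | true  = contradiction (to (extends⇔≼ (S [ v ≔ false ]) σ) (∧-conicalʳ (satisfies D σ) _ sat∧ext))
                    (forced-false-unsat (to (forcedᵇ⇔ S v) forced) (∧-conicalˡ _ _ sat∧ext))

  guarded-update-away : ∀ {S v c} b → S v ≡ nothing → clauseLeaf D c ≢ v →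
                        ClauseGuarded S c → ClauseGuarded (S [ v ≔ b ]) c
  guarded-update-away {S} b Sv l≢v = clauseGuarded-⊑ (⊑-update b Sv) (update-≢ S b l≢v)

  guarded-update-nonLeafVar : ∀ {S v} b → Guarded D S → S v ≡ nothing → isLeafVar D v ≡ false →
                              Guarded D (S [ v ≔ b ])
  guarded-update-nonLeafVar b g Sv nonLeaf c c∈ =
    guarded-update-away b Sv (nonLeafVar≢clauseLeaf c∈ nonLeaf ∘ sym) (g c c∈)

  NonLeafVarsSet : Literals D → Set
  NonLeafVarsSet S = ∀ u → isLeafVar D u ≡ false → S u ≢ nothing

  guarded-update-clauseLeaf : ∀ {S v c} b → S v ≡ nothing → NonLeafVarsSet S → c ∈ pseudoedges D →
    clauseLeaf D c ≡ v → (b ≡ true ⊎ forcedᵇ S v ≡ false) → ClauseGuarded (S [ v ≔ b ]) c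
  guarded-update-clauseLeaf {S} {v} {c} b Sv set c∈ l≡v allowed with othersNegativeᵇ S c in negᵇ
  ... | false with u , u∈ , u≢l , notNeg ← othersNegative-witness negᵇ =
    inj₂ (inj₁ (u , u∈ , nonLeaf , ⊑-update b Sv u (positive (S u) refl notNeg)))
    where
    nonLeaf : isLeafVar D u ≡ false
    nonLeaf = clause-nonLeafVar c∈ u∈ u≢l
    positive : ∀ x → S u ≡ x → isNeg D x ≡ false → S u ≡ just true
    positive nothing     Su≡x _ = contradiction Su≡x (set u nonLeaf)
    positive (just true) Su≡x _ = Su≡x
  ... | true with allowed
  ...   | inj₁ refl = inj₂ (inj₂ (trans (cong (S [ v ≔ true ]) l≡v) (update-≡ S v true) ,
                        othersNegative-agree (λ w w≢l → update-≢ S true (λ w≡v → w≢l (trans w≡v (sym l≡v))))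
                                             (othersNegative-elim negᵇ)))
  ...   | inj₂ unforced =
    ⊥-elim (not-¬ (from (forcedᵇ⇔ S v) (c , c∈ , l≡v , othersNegative-elim negᵇ)) unforced)

  guarded-update-leaf : ∀ {S v} b → Guarded D S → S v ≡ nothing → NonLeafVarsSet S →
                        (b ≡ true ⊎ forcedᵇ S v ≡ false) → Guarded D (S [ v ≔ b ])
  guarded-update-leaf {S} {v} b g Sv set allowed c c∈ = by-cases (clauseLeaf D c ≟ v)
    where
    by-cases : Dec (clauseLeaf D c ≡ v) → ClauseGuarded (S [ v ≔ b ]) c
    by-cases (no l≢v)  = guarded-update-away b Sv l≢v (g c c∈)
    by-cases (yes l≡v) = guarded-update-clauseLeaf b Sv set c∈ l≡v allowed

  ExactPrEC : Literals D → Set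
  ExactPrEC S = PrEC D S ≡ halfPow (sizeNonFix D S)

  guarded-total-satisfies : ∀ {S τ} → Guarded D S → (∀ v → S v ≡ just (τ v)) → satisfies D τ ≡ true
  guarded-total-satisfies {S} {τ} g S≡τ = all-intro _ (pseudoedges D) λ {c} c∈ → clause-true c (g c c∈)
    where
    true-at : ∀ {w} → S w ≡ just true → τ w ≡ true
    true-at Sw = Maybe.just-injective (trans (sym (S≡τ _)) Sw)
    clause-true : ∀ c → ClauseGuarded S c → any τ (clauseVars D c) ≡ true
    clause-true c (inj₁ unset) = contradiction (trans (sym (S≡τ _)) unset) λ ()
    clause-true c (inj₂ (inj₁ (w , w∈ , _ , Sw))) = any-intro τ w∈ (true-at Sw)
    clause-true c (inj₂ (inj₂ (Sl , _))) = any-intro τ (clauseLeaf∈clauseVars D c) (true-at Sl)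

  exact-total : ∀ {S} → Guarded D S → (∀ v → S v ≢ nothing) → ExactPrEC S
  exact-total {S} g set = begin
    PrEC D S          ≡⟨ PrEC-Sum S ⟩
    Sum n (weight S)  ≡⟨ Sum-indicator _ (PrPoint D) τ selects-τ PrPoint-ext ⟩
    PrPoint D τ       ≡⟨ cong halfPow (sizeNonFix-cong (sym ∘ S≡τ)) ⟩
    halfPow (sizeNonFix D S) ∎
    where
    open ≡-Reasoning
    PrPoint-ext : Extensional (PrPoint D)
    PrPoint-ext σ≗σ' = cong halfPow (sizeNonFix-cong (cong just ∘ σ≗σ'))
    τ : Assignment n
    τ v = isPos D (S v)
    S≡τ : ∀ v → S v ≡ just (τ v)
    S≡τ v with S v | set v
    ... | nothing | unset = contradiction refl unset
    ... | just true  | _ = refl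
    ... | just false | _ = refl
    selects-τ : ∀ σ → satisfies D σ ∧ extends D S σ ≡ true ⇔ σ ≗ τ
    selects-τ σ = mk⇔
      (λ sat∧ext v → to (extends⇔≼ S σ) (∧-conicalʳ (satisfies D σ) _ sat∧ext) v (S≡τ v))
      (λ σ≗τ → cong₂ _∧_ (trans (satisfies-cong σ≗τ) (guarded-total-satisfies g S≡τ))
                          (from (extends⇔≼ S σ) λ v Sv →
                            trans (σ≗τ v) (Maybe.just-injective (trans (sym (S≡τ v)) Sv))))

  exact-unforced : ∀ {S v} → Guarded D S → S v ≡ nothing → forcedᵇ S v ≡ false →
                   (∀ b → ExactPrEC (S [ v ≔ b ])) → ExactPrEC S
  exact-unforced {S} {v} g Sv unforced exact = begin
    PrEC D S                                            ≡⟨ PrEC-split Sv ⟩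
    PrEC D (S [ v ≔ true ]) +ℚ PrEC D (S [ v ≔ false ]) ≡⟨ cong₂ _+ℚ_ (branch true) (branch false) ⟩
    halfPow (suc s) +ℚ halfPow (suc s)                  ≡⟨ halfPow-double s ⟩
    halfPow s                                           ∎
    where
    open ≡-Reasoning
    s = sizeNonFix D S
    branch : ∀ b → PrEC D (S [ v ≔ b ]) ≡ halfPow (suc s)
    branch b = trans (exact b) (cong halfPow (sizeNonFix-update-unforced b g Sv unforced))

  exact-forced : ∀ {S v} → Guarded D S → S v ≡ nothing → forcedᵇ S v ≡ true →
                 ExactPrEC (S [ v ≔ true ]) → ExactPrEC S
  exact-forced {S} {v} g Sv forced exact = begin
    PrEC D S                                            ≡⟨ PrEC-split Sv ⟩
    PrEC D (S [ v ≔ true ]) +ℚ PrEC D (S [ v ≔ false ]) ≡⟨ cong₂ _+ℚ_ exact (PrEC-forced-false forced) ⟩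
    halfPow (sizeNonFix D (S [ v ≔ true ])) +ℚ 0ℚ      ≡⟨ ℚ.+-identityʳ _ ⟩
    halfPow (sizeNonFix D (S [ v ≔ true ]))             ≡⟨ cong halfPow (sizeNonFix-update-forced g Sv forced) ⟩
    halfPow (sizeNonFix D S)                            ∎
    where open ≡-Reasoning

  unsetCount : Literals D → ℕ
  unsetCount S = count (is-nothing ∘ S) (allFin n)

  unsetCount-update : ∀ {S v} b → S v ≡ nothing → unsetCount S ≡ suc (unsetCount (S [ v ≔ b ]))
  unsetCount-update {S} {v} b Sv = count-insert (is-nothing ∘ (S [ v ≔ b ])) (is-nothing ∘ S) v
    (λ w w≢v → cong is-nothing (sym (update-≢ S b w≢v))) (cong is-nothing (update-≡ S v b)) (cong is-nothing Sv)

  exact-nonLeafVar : ∀ {S v} → Guarded D S → S v ≡ nothing → isLeafVar D v ≡ false →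
                     (∀ b → Guarded D (S [ v ≔ b ]) → ExactPrEC (S [ v ≔ b ])) → ExactPrEC S
  exact-nonLeafVar g Sv nonLeaf exact =
    exact-unforced g Sv (forcedᵇ-nonLeafVar nonLeaf) λ b → exact b (guarded-update-nonLeafVar b g Sv nonLeaf)

  exact-leafVar : ∀ {S v} → Guarded D S → S v ≡ nothing → NonLeafVarsSet S →
                  (∀ b → Guarded D (S [ v ≔ b ]) → ExactPrEC (S [ v ≔ b ])) → ExactPrEC S
  exact-leafVar {S} {v} g Sv set exact with forcedᵇ S v in forced
  ... | true  = exact-forced g Sv forced (exact true (guarded-update-leaf true g Sv set (inj₁ refl)))
  ... | false = exact-unforced g Sv forced λ b → exact b (guarded-update-leaf b g Sv set (inj₂ forced))

  is-nothing-true : ∀ {x : Maybe Bool} → is-nothing x ≡ true → x ≡ nothing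
  is-nothing-true {nothing} _ = refl

  exactPrEC : ∀ k S → Guarded D S → unsetCount S ≡ k → ExactPrEC S
  exactPrEC zero S g none-unset = exact-total g λ v Sv →
    contradiction (trans (sym (cong is-nothing Sv)) (count-zero (is-nothing ∘ S) none-unset (∈-allFin v))) λ ()
  exactPrEC (suc k) S g k+1-unset =
    by-cases (any? λ v → Maybe.≡-dec Bool._≟_ (S v) nothing ×-dec (isLeafVar D v Bool.≟ false))
    where
    next : ∀ {v} → S v ≡ nothing → ∀ b → Guarded D (S [ v ≔ b ]) → ExactPrEC (S [ v ≔ b ])
    next Sv b g' = exactPrEC k _ g' (ℕ.suc-injective (trans (sym (unsetCount-update b Sv)) k+1-unset))
    by-cases : Dec (∃[ v ] (S v ≡ nothing × isLeafVar D v ≡ false)) → ExactPrEC S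
    by-cases (yes (v , Sv , nonLeaf)) = exact-nonLeafVar g Sv nonLeaf (next Sv)
    by-cases (no no-unset-inner) with v , v-unset ← count-suc (is-nothing ∘ S) (allFin n) k+1-unset =
      exact-leafVar g (is-nothing-true v-unset) (λ u nonLeaf Su → no-unset-inner (u , Su , nonLeaf))
                    (next (is-nothing-true v-unset))

lemma14 : ∀ {n m : ℕ} (D : TreeData n m) → IsPseudoexpander D →
          (S : Literals D) → Guarded D S →
          PrEC D S ≡ halfPow (sizeNonFix D S)
lemma14 D H S g = exactPrEC D (clauseLeaf-isLeafVar D btb) (clauseVars-nonLeafVar D btb) _ S g refl
  where open IsPseudoexpander H
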